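{- In the binary tree instance described in the context, for every node $v$, the total size instantiation observed under the adaptive policy $\mathcal{A}$ before reaching $v$, namely $\sum s_u$ over all strict ancestors $u$ of $v$ such that $v$ lies in the subtree of the right child of $u$, is strictly less than $s_v$.
   Context: Let $L\ge 2$ be an integer and $B:=2^{2^{L+1}}$. Let $\mathcal{T}$ be a complete binary tree with root $\rho$ in which every root-to-leaf path has $L$ nodes; each internal node has a left and a right child. The level $\ell(v)$ of a node is the number of nodes on the path from $v$ to a leaf (leaves have level 1, the root level $L$). Each node $v$ has a job whose size is $0$ or a positive value $s_v$, where $s_\rho:=2^{2^L}$, and for a node $v$ with parent $u$, $s_v:=s_u\cdot 2^{2^{\ell(v)}}$ if $v$ is the right child and $s_v:=s_u\cdot 2^{ -2^{\ell(v)}}$ if $v$ is the left child. The adaptive policy $\mathcal{A}$ starts at $\rho$, processes the job at the current node, and moves to the left child if the size was $0$ and to the right child if it was positive; thus to reach $v$, $\mathcal{A}$ observes size $s_u$ exactly at those ancestors $u$ where the path to $v$ goes right. -}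

module Defs where

open import Data.Nat as ℕ using (ℕ; zero; suc; _∸_; _^_)
open import Data.Nat.Properties using (m^n≢0)
open import Data.Integer using (+_)
open import Data.Rational using (ℚ; _/_; _+_; _*_; 0ℚ)
open import Data.Bool using (Bool; true; false)
open import Data.List using (List; []; _∷_; _++_; [_])

-- A node of the tree T is identified by its path from the root ρ:
-- a list of directions, true = right child, false = left child. With L nodes on every root-to-leaf path, the nodes
-- are exactly the paths of length < L; a node with path p has level
-- L ∸ length p.

pow2 : ℕ → ℚ
pow2 k = + (2 ^ k) / 1

invPow2 : ℕ → ℚ
invPow2 k = (+ 1 / (2 ^ k)) {{m^n≢0 2 k}}

-- sizeFrom ℓ x p : size of the node reached by following path p from a
-- node of level ℓ and size x.
sizeFrom : ℕ → ℚ → List Bool → ℚ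
sizeFrom ℓ x [] = x
sizeFrom ℓ x (true ∷ p) = sizeFrom (ℓ ∸ 1) (x * pow2 (2 ^ (ℓ ∸ 1))) p
sizeFrom ℓ x (false ∷ p) = sizeFrom (ℓ ∸ 1) (x * invPow2 (2 ^ (ℓ ∸ 1))) p

size : ℕ → List Bool → ℚ
size L p = sizeFrom L (pow2 (2 ^ L)) p

observedFrom : ℕ → List Bool → List Bool → ℚ
observedFrom L pre [] = 0ℚ
observedFrom L pre (true ∷ p) = size L pre + observedFrom L (pre ++ [ true ]) p
observedFrom L pre (false ∷ p) = observedFrom L (pre ++ [ false ]) p

observed : ℕ → List Bool → ℚ
observed L p = observedFrom L [] p

module Submission where

-- Put slack ℓ = 2^-(2^ℓ - 1).  Walking down the path to v, we keep
-- the invariant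
--     (sizes observed so far) ≤ (size of the current node) · slack (its level).
-- It holds at the root (nothing observed yet).  Going left multiplies the
-- size by 2^-(2^k) and divides the slack by the same factor
-- (slack (k+1) = 2^-(2^k) · slack k), so the bound is unchanged.  Going right
-- adds the current size x to the observed total, but the bound grows from
-- x · slack (k+1) ≤ x to 2^(2^k) · x · slack k = 2x, which absorbs it.
-- At v, of level ≥ 1, the slack is at most 1/2 < 1, giving the claim.

module ObservedBound where

  open import Defs
  open import Data.Nat as ℕ using (ℕ; suc; _∸_; _^_)
  import Data.Nat.Properties as ℕP
  open import Data.Nat.Tactic.RingSolver using (solve-∀)
  open import Data.Integer as ℤ using (+_)
  import Data.Integer.Properties as ℤP
  open import Data.Rational
    using (ℚ; _/_; _+_; _*_; 0ℚ; 1ℚ; _≤_; _<_; toℚᵘ; Positive; NonNegative)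
  open import Data.Rational.Properties
  import Data.Rational.Unnormalised as ℚᵘ
  import Data.Rational.Unnormalised.Properties as ℚᵘP
  open import Data.Bool using (Bool; true; false)
  open import Data.List using (List; []; _∷_; _++_; [_]; length)
  import Data.List.Properties as ListP
  open import Relation.Binary.PropositionalEquality hiding ([_])

  -- Each fact is transported from the unnormalised
  -- rationals, where it holds by definition; toℚᵘ-/ is the bridge.
  toℚᵘ-/ : ∀ i d .{{_ : ℕ.NonZero d}} → toℚᵘ (i / d) ℚᵘ.≃ (i ℚᵘ./ d)
  toℚᵘ-/ i (suc d) = toℚᵘ-fromℚᵘ (ℚᵘ.mkℚᵘ i d)

  /-≡ : ∀ n m c d .{{_ : ℕ.NonZero c}} .{{_ : ℕ.NonZero d}} →
        n ℕ.* d ≡ m ℕ.* c → + n / c ≡ + m / d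
  /-≡ n m c@(suc _) d@(suc _) eq = toℚᵘ-injective (ℚᵘP.≃-trans (toℚᵘ-/ (+ n) c)
    (ℚᵘP.≃-trans (ℚᵘ.*≡* (trans (sym (ℤP.pos-* n d)) (trans (cong +_ eq) (ℤP.pos-* m c))))
                 (ℚᵘP.≃-sym (toℚᵘ-/ (+ m) d))))

  /-≤ : ∀ n m c d .{{_ : ℕ.NonZero c}} .{{_ : ℕ.NonZero d}} →
        n ℕ.* d ℕ.≤ m ℕ.* c → + n / c ≤ + m / d
  /-≤ n m c@(suc _) d@(suc _) le = toℚᵘ-cancel-≤
    (ℚᵘP.≤-respʳ-≃ (ℚᵘP.≃-sym (toℚᵘ-/ (+ m) d)) (ℚᵘP.≤-respˡ-≃ (ℚᵘP.≃-sym (toℚᵘ-/ (+ n) c))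
      (ℚᵘ.*≤* (subst₂ ℤ._≤_ (ℤP.pos-* n d) (ℤP.pos-* m c) (ℤ.+≤+ le)))))

  /-< : ∀ n m c d .{{_ : ℕ.NonZero c}} .{{_ : ℕ.NonZero d}} →
        n ℕ.* d ℕ.< m ℕ.* c → + n / c < + m / d
  /-< n m c@(suc _) d@(suc _) lt = toℚᵘ-cancel-<
    (ℚᵘP.<-respʳ-≃ (ℚᵘP.≃-sym (toℚᵘ-/ (+ m) d)) (ℚᵘP.<-respˡ-≃ (ℚᵘP.≃-sym (toℚᵘ-/ (+ n) c))
      (ℚᵘ.*<* (subst₂ ℤ._<_ (ℤP.pos-* n d) (ℤP.pos-* m c) (ℤ.+<+ lt)))))

  /-* : ∀ n m c d .{{_ : ℕ.NonZero c}} .{{_ : ℕ.NonZero d}} .{{_ : ℕ.NonZero (c ℕ.* d)}} →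
        (+ n / c) * (+ m / d) ≡ + (n ℕ.* m) / (c ℕ.* d)
  /-* n m c@(suc _) d@(suc _) = toℚᵘ-injective (ℚᵘP.≃-trans (toℚᵘ-homo-* (+ n / c) (+ m / d))
    (ℚᵘP.≃-trans (ℚᵘP.*-cong (toℚᵘ-/ (+ n) c) (toℚᵘ-/ (+ m) d))
    (ℚᵘP.≃-trans (ℚᵘP.≃-reflexive (ℚᵘP./-cong (sym (ℤP.pos-* n m)) refl))
                 (ℚᵘP.≃-sym (toℚᵘ-/ (+ (n ℕ.* m)) (c ℕ.* d))))))

  2^≢0 : ∀ k → ℕ.NonZero (2 ^ k)
  2^≢0 k = ℕP.m^n≢0 2 k

  pow2-pos : ∀ k → Positive (pow2 k)
  pow2-pos k = normalize-pos (2 ^ k) 1 {{_}} {{2^≢0 k}}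

  invPow2-pos : ∀ k → Positive (invPow2 k)
  invPow2-pos k = normalize-pos 1 (2 ^ k) {{2^≢0 k}}

  invPow2-+ : ∀ a b → invPow2 a * invPow2 b ≡ invPow2 (a ℕ.+ b)
  invPow2-+ a b = trans (/-* 1 1 (2 ^ a) (2 ^ b) {{2^≢0 a}} {{2^≢0 b}} {{2^a*2^b≢0}})
    (/-cong {+ 1} {_} {+ 1} {_} {{2^a*2^b≢0}} {{2^≢0 (a ℕ.+ b)}} refl (sym (ℕP.^-distribˡ-+-* 2 a b)))
    where
    2^a*2^b≢0 : ℕ.NonZero (2 ^ a ℕ.* 2 ^ b)
    2^a*2^b≢0 = ℕP.m*n≢0 (2 ^ a) (2 ^ b) {{2^≢0 a}} {{2^≢0 b}}

  pow2-suc-* : ∀ m → pow2 (suc m) * invPow2 m ≡ 1ℚ + 1ℚ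
  pow2-suc-* m = trans (/-* (2 ^ suc m) 1 1 (2 ^ m) {{_}} {{2^≢0 m}} {{1*2^m≢0}})
    (/-≡ (2 ^ suc m ℕ.* 1) 2 (1 ℕ.* 2 ^ m) 1 {{1*2^m≢0}} (cross (2 ^ m)))
    where
    1*2^m≢0 : ℕ.NonZero (1 ℕ.* 2 ^ m)
    1*2^m≢0 = ℕP.m*n≢0 1 (2 ^ m) {{_}} {{2^≢0 m}}
    cross : ∀ t → (2 ℕ.* t ℕ.* 1) ℕ.* 1 ≡ 2 ℕ.* (1 ℕ.* t)
    cross = solve-∀

  invPow2≤1 : ∀ e → invPow2 e ≤ 1ℚ
  invPow2≤1 e = /-≤ 1 1 (2 ^ e) 1 {{2^≢0 e}}
    (subst (1 ℕ.≤_) (sym (ℕP.*-identityˡ (2 ^ e))) (ℕP.m^n>0 2 e))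

  invPow2<1 : ∀ e → 1 ℕ.≤ e → invPow2 e < 1ℚ
  invPow2<1 e 1≤e = /-< 1 1 (2 ^ e) 1 {{2^≢0 e}}
    (subst (1 ℕ.<_) (sym (ℕP.*-identityˡ (2 ^ e))) (ℕP.^-monoʳ-≤ 2 1≤e))

  -- The slack of a node of level ℓ: the fraction of its size that may already
  -- have been observed.  It shrinks rapidly towards the root.
  slack : ℕ → ℚ
  slack ℓ = invPow2 (2 ^ ℓ ∸ 1)

  exponent-suc : ∀ k → 2 ^ suc k ∸ 1 ≡ 2 ^ k ℕ.+ (2 ^ k ∸ 1)
  exponent-suc k = begin
    2 ^ suc k ∸ 1             ≡⟨ cong (λ t → (2 ^ k ℕ.+ t) ∸ 1) (ℕP.+-identityʳ (2 ^ k)) ⟩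
    (2 ^ k ℕ.+ 2 ^ k) ∸ 1     ≡⟨ ℕP.+-∸-assoc (2 ^ k) (ℕP.m^n>0 2 k) ⟩
    2 ^ k ℕ.+ (2 ^ k ∸ 1)     ∎
    where open ≡-Reasoning

  slack-left : ∀ k → invPow2 (2 ^ k) * slack k ≡ slack (suc k)
  slack-left k = trans (invPow2-+ (2 ^ k) (2 ^ k ∸ 1)) (cong invPow2 (sym (exponent-suc k)))

  slack-right : ∀ k → pow2 (2 ^ k) * slack k ≡ 1ℚ + 1ℚ
  slack-right k = pow2-*-pred (2 ^ k) (ℕP.m^n>0 2 k)
    where
    pow2-*-pred : ∀ n → 0 ℕ.< n → pow2 n * invPow2 (n ∸ 1) ≡ 1ℚ + 1ℚ
    pow2-*-pred (suc m) _ = pow2-suc-* m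

  slack≤1 : ∀ ℓ → slack ℓ ≤ 1ℚ
  slack≤1 ℓ = invPow2≤1 (2 ^ ℓ ∸ 1)

  slack<1 : ∀ ℓ → 0 ℕ.< ℓ → slack ℓ < 1ℚ
  slack<1 (suc k) _ = invPow2<1 (2 ^ suc k ∸ 1)
    (ℕP.∸-monoˡ-≤ 1 (ℕP.^-monoʳ-≤ 2 {1} {suc k} (ℕ.s≤s ℕ.z≤n)))

  child : ℕ → ℚ → Bool → ℚ
  child ℓ x true = x * pow2 (2 ^ (ℓ ∸ 1))
  child ℓ x false = x * invPow2 (2 ^ (ℓ ∸ 1))

  sizeFrom-∷ : ∀ ℓ x b p → sizeFrom ℓ x (b ∷ p) ≡ sizeFrom (ℓ ∸ 1) (child ℓ x b) p
  sizeFrom-∷ ℓ x true p = refl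
  sizeFrom-∷ ℓ x false p = refl

  child-pos : ∀ ℓ x b → .{{Positive x}} → Positive (child ℓ x b)
  child-pos ℓ x true = pos*pos⇒pos x (pow2 k) {{pow2-pos k}} where k = 2 ^ (ℓ ∸ 1)
  child-pos ℓ x false = pos*pos⇒pos x (invPow2 k) {{invPow2-pos k}} where k = 2 ^ (ℓ ∸ 1)

  sizeFrom-pos : ∀ ℓ x p → {{Positive x}} → Positive (sizeFrom ℓ x p)
  sizeFrom-pos ℓ x [] {{x>0}} = x>0
  sizeFrom-pos ℓ x (b ∷ p) rewrite sizeFrom-∷ ℓ x b p =
    sizeFrom-pos (ℓ ∸ 1) (child ℓ x b) p {{child-pos ℓ x b}}

  sizeFrom-++ : ∀ ℓ x p q →
                sizeFrom ℓ x (p ++ q) ≡ sizeFrom (ℓ ∸ length p) (sizeFrom ℓ x p) q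
  sizeFrom-++ ℓ x [] q = refl
  sizeFrom-++ ℓ x (b ∷ p) q = begin
    sizeFrom ℓ x (b ∷ p ++ q)
      ≡⟨ sizeFrom-∷ ℓ x b (p ++ q) ⟩
    sizeFrom (ℓ ∸ 1) (child ℓ x b) (p ++ q)
      ≡⟨ sizeFrom-++ (ℓ ∸ 1) (child ℓ x b) p q ⟩
    sizeFrom (ℓ ∸ 1 ∸ length p) (sizeFrom (ℓ ∸ 1) (child ℓ x b) p) q
      ≡⟨ cong₂ (λ ℓ′ y → sizeFrom ℓ′ y q) (ℕP.∸-+-assoc ℓ 1 (length p)) (sym (sizeFrom-∷ ℓ x b p)) ⟩
    sizeFrom (ℓ ∸ length (b ∷ p)) (sizeFrom ℓ x (b ∷ p)) q
      ∎
    where open ≡-Reasoning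

  level-snoc : ∀ L (pre : List Bool) b → L ∸ length (pre ++ [ b ]) ≡ L ∸ length pre ∸ 1
  level-snoc L pre b = trans (cong (L ∸_) (ListP.length-++ pre)) (sym (ℕP.∸-+-assoc L (length pre) 1))

  size-snoc : ∀ L pre b → size L (pre ++ [ b ]) ≡ child (L ∸ length pre) (size L pre) b
  size-snoc L pre b = trans (sizeFrom-++ L (pow2 (2 ^ L)) pre [ b ]) (sizeFrom-∷ _ _ b [])

  observedBelow : ℕ → ℚ → List Bool → ℚ
  observedBelow ℓ x [] = 0ℚ
  observedBelow ℓ x (true ∷ p) = x + observedBelow (ℓ ∸ 1) (child ℓ x true) p
  observedBelow ℓ x (false ∷ p) = observedBelow (ℓ ∸ 1) (child ℓ x false) p

  -- observedFrom, which recomputes every size from the root, only depends on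
  -- the level and size of the node reached by the prefix; observedFrom-snoc
  -- is the one-step version used in its inductive step.
  observedFrom-local : ∀ L pre p →
    observedFrom L pre p ≡ observedBelow (L ∸ length pre) (size L pre) p
  observedFrom-snoc : ∀ L pre b p → observedFrom L (pre ++ [ b ]) p ≡
    observedBelow (L ∸ length pre ∸ 1) (child (L ∸ length pre) (size L pre) b) p

  observedFrom-local L pre [] = refl
  observedFrom-local L pre (true ∷ p) = cong (λ o → size L pre + o) (observedFrom-snoc L pre true p)
  observedFrom-local L pre (false ∷ p) = observedFrom-snoc L pre false p

  observedFrom-snoc L pre b p = trans (observedFrom-local L (pre ++ [ b ]) p)
    (cong₂ (λ ℓ x → observedBelow ℓ x p) (level-snoc L pre b) (size-snoc L pre b))

  -- A right step: what is observed there, the current size x, is absorbed by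
  -- the growth of the bound from x · slack (k+1) ≤ x to 2x.
  slack-absorbs : ∀ k x → .{{NonNegative x}} →
                  x * slack (suc k) + x ≤ child (suc k) x true * slack k
  slack-absorbs k x = begin
    x * slack (suc k) + x         ≤⟨ +-mono-≤ (*-monoˡ-≤-nonNeg x (slack≤1 (suc k)))
                                               (≤-reflexive (sym (*-identityʳ x))) ⟩
    x * 1ℚ + x * 1ℚ               ≡⟨ sym (*-distribˡ-+ x 1ℚ 1ℚ) ⟩
    x * (1ℚ + 1ℚ)                 ≡⟨ cong (x *_) (sym (slack-right k)) ⟩
    x * (pow2 (2 ^ k) * slack k)  ≡⟨ sym (*-assoc x (pow2 (2 ^ k)) (slack k)) ⟩
    x * pow2 (2 ^ k) * slack k    ∎
    where open ≤-Reasoning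

  slack-transfers : ∀ k x → x * slack (suc k) ≡ child (suc k) x false * slack k
  slack-transfers k x = trans (cong (x *_) (sym (slack-left k)))
                              (sym (*-assoc x (invPow2 (2 ^ k)) (slack k)))

  observed-invariant : ∀ ℓ x O p → length p ℕ.< ℓ → .{{Positive x}} → O ≤ x * slack ℓ →
    O + observedBelow ℓ x p ≤ sizeFrom ℓ x p * slack (ℓ ∸ length p)
  observed-invariant ℓ x O [] _ O≤ = ≤-trans (≤-reflexive (+-identityʳ O)) O≤
  observed-invariant (suc k) x O (true ∷ p) (ℕ.s≤s p<k) O≤ = begin
    O + (x + observedBelow k x′ p)  ≡⟨ sym (+-assoc O x _) ⟩
    (O + x) + observedBelow k x′ p  ≤⟨ observed-invariant k x′ (O + x) p p<k {{child-pos (suc k) x true}}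
                                         (≤-trans (+-monoˡ-≤ x O≤) (slack-absorbs k x {{pos⇒nonNeg x}})) ⟩
    sizeFrom k x′ p * slack (k ∸ length p) ∎
    where
    x′ = child (suc k) x true
    open ≤-Reasoning
  observed-invariant (suc k) x O (false ∷ p) (ℕ.s≤s p<k) O≤ =
    observed-invariant k (child (suc k) x false) O p p<k {{child-pos (suc k) x false}}
      (subst (O ≤_) (slack-transfers k x) O≤)

  observedBelow-bound : ∀ ℓ x p → length p ℕ.< ℓ → .{{Positive x}} →
    observedBelow ℓ x p ≤ sizeFrom ℓ x p * slack (ℓ ∸ length p)
  observedBelow-bound ℓ x p p<ℓ =
    subst (_≤ sizeFrom ℓ x p * slack (ℓ ∸ length p)) (+-identityˡ (observedBelow ℓ x p))
    (observed-invariant ℓ x 0ℚ p p<ℓ (nonNegative⁻¹ (x * slack ℓ) {{x·slack≥0}}))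
    where
    x·slack≥0 : NonNegative (x * slack ℓ)
    x·slack≥0 = pos⇒nonNeg (x * slack ℓ) {{pos*pos⇒pos x (slack ℓ) {{invPow2-pos (2 ^ ℓ ∸ 1)}}}}

open import Defs
open import Data.Nat using (ℕ; _≤_; _∸_; _^_)
import Data.Nat as ℕ
open import Data.Bool using (Bool)
open import Data.List using (List; []; length)
open import Data.Rational using (_<_; _*_; 1ℚ)
open import Data.Nat.Properties using (m<n⇒0<n∸m)
open import Data.Rational.Properties using (module ≤-Reasoning; *-monoʳ-<-pos; *-identityʳ)
open ObservedBound

-- The observed total is at most s_v · slack (level of v), and as v has
-- level ≥ 1 its slack is < 1.
lemma2 : (L : ℕ) → 2 ≤ L → (v : List Bool) → length v ℕ.< L →
    observed L v < size L v
lemma2 L _ v v<L = begin-strict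
  observed L v                          ≡⟨ observedFrom-local L [] v ⟩
  observedBelow L (size L []) v         ≤⟨ observedBelow-bound L (size L []) v v<L {{pow2-pos (2 ^ L)}} ⟩
  size L v * slack (L ∸ length v)       <⟨ *-monoʳ-<-pos (size L v) {{sizeFrom-pos L _ v {{pow2-pos (2 ^ L)}}}}
                                             (slack<1 (L ∸ length v) (m<n⇒0<n∸m v<L)) ⟩
  size L v * 1ℚ                         ≡⟨ *-identityʳ (size L v) ⟩
  size L v                              ∎
  where open ≤-Reasoning
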